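{- If $\mathsf V$ is a subvariety of $\mathsf{OML}$ axiomatized relative to orthomodular lattices by a set $E$ of equations, then $\mathsf V$ is translatable into $\mathsf{ROL}+\mathrm T[E]$. In particular, $\mathsf{OML}$ is translatable into $\mathsf{ROL}$.
   Context: A residuated ortholattice (ROL) is an algebra $(A,\wedge,\vee,\neg,\backslash,0,1)$ where $(A,\wedge,\vee,0,1)$ is a bounded lattice, $\neg$ is an order-reversing involution, and $x\cdot y\le z\iff y\le x\backslash z$ for all $x,y,z$, where $x\cdot y:=x\wedge(\neg x\vee y)$; $\mathsf{ROL}$ is the variety of ROLs. Orthomodular lattices are regarded as ROLs with $x\backslash y:=\neg x\vee(x\wedge y)$; $\mathsf{OML}$ denotes this subvariety; $E$ is a set of equations in the ROL language. $\mathsf K+E$ is the subvariety of $\mathsf K$ axiomatized by $E$. Let ${\sim}x:=x\backslash 0$. The translation $\mathrm T$: $\mathrm T(0)=0$, $\mathrm T(1)=1$, $\mathrm T(x)={\sim}{\sim}x$ for variables, $\mathrm T(\neg s)={\sim}\mathrm T(s)$, $\mathrm T(r\star s)=\mathrm T(r)\star\mathrm T(s)$ for $\star\in\{\wedge,\vee,\backslash\}$; $\mathrm T[E]:=\{\mathrm T(u)\approx\mathrm T(v):(u\approx v)\in E\}$. For varieties $\mathsf V,\mathsf W$ of ROLs, $\mathsf V$ is translatable into $\mathsf W$ if for every set of ROL equations $D\cup\{s\approx t\}$: $D\models_{\mathsf V}s\approx t$ iff $\mathrm T[D]\models_{\mathsf W}\mathrm T(s)\approx\mathrm T(t)$, where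 $\models_{\mathsf K}$ is relative equational consequence over $\mathsf K$. -}

module Defs where

open import Level using (Level; 0ℓ) renaming (suc to lsuc)
open import Data.Nat using (ℕ)
open import Data.Product using (_×_; _,_; proj₁; proj₂; Σ-syntax)
open import Relation.Binary.PropositionalEquality using (_≡_)
open import Relation.Unary using (Pred)
open import Algebra.Core using (Op₁; Op₂)
open import Algebra.Lattice.Structures using (IsLattice)
open import Function.Bundles using (_⇔_)
open import Data.Unit.Polymorphic using (⊤)

infixr 7 _∧ₜ_
infixr 6 _∨ₜ_
infixr 5 _⇒ₜ_

-- Terms and equations in the ROL language (∧, ∨, ¬, ⇒ₜ for the residual \, 0, 1),
-- over the countable set of variables ℕ.

data Term : Set where
  var       : ℕ → Term
  0ₜ 1ₜ     : Term
  ¬ₜ_       : Term → Term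
  _∧ₜ_ _∨ₜ_ _⇒ₜ_ : Term → Term → Term

Eqn : Set
Eqn = Term × Term

EqSet : Set₁
EqSet = Pred Eqn 0ℓ

record ROL : Set₁ where
  infix  4 _≈_ _≤_
  infixr 7 _∧_ _·_
  infixr 6 _∨_
  infixr 5 _⇛_
  field
    Carrier : Set
    _≈_     : Carrier → Carrier → Set
    _∧_ _∨_ _⇛_ : Op₂ Carrier
    ¬_      : Op₁ Carrier
    𝟘 𝟙     : Carrier
    isLattice : IsLattice _≈_ _∨_ _∧_

  _≤_ : Carrier → Carrier → Set
  x ≤ y = (x ∧ y) ≈ x

  _·_ : Op₂ Carrier
  x · y = x ∧ (¬ x ∨ y)

  field
    𝟘-least    : ∀ x → 𝟘 ≤ x
    𝟙-greatest : ∀ x → x ≤ 𝟙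
    ¬-cong     : ∀ {x y} → x ≈ y → (¬ x) ≈ (¬ y)
    ¬-involutive : ∀ x → (¬ (¬ x)) ≈ x
    ¬-antitone : ∀ {x y} → x ≤ y → ¬ y ≤ ¬ x
    ⇛-cong    : ∀ {x y u v} → x ≈ y → u ≈ v → (x ⇛ u) ≈ (y ⇛ v)
    residuated : ∀ x y z → (x · y ≤ z) ⇔ (y ≤ x ⇛ z)

  open IsLattice isLattice public

Class : Set₁
Class = Pred ROL 0ℓ

module _ (A : ROL) where
  open ROL A

  ⟦_⟧ : Term → (ℕ → Carrier) → Carrier
  ⟦ var n ⟧   ρ = ρ n
  ⟦ 0ₜ ⟧      ρ = 𝟘
  ⟦ 1ₜ ⟧      ρ = 𝟙
  ⟦ ¬ₜ s ⟧    ρ = ¬ (⟦ s ⟧ ρ)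
  ⟦ s ∧ₜ t ⟧  ρ = ⟦ s ⟧ ρ ∧ ⟦ t ⟧ ρ
  ⟦ s ∨ₜ t ⟧  ρ = ⟦ s ⟧ ρ ∨ ⟦ t ⟧ ρ
  ⟦ s ⇒ₜ t ⟧  ρ = ⟦ s ⟧ ρ ⇛ ⟦ t ⟧ ρ

  SatBy : (ℕ → Carrier) → Eqn → Set
  SatBy ρ (s , t) = ⟦ s ⟧ ρ ≈ ⟦ t ⟧ ρ

  Models : Eqn → Set
  Models e = ∀ (ρ : ℕ → Carrier) → SatBy ρ e

_⊨[_]_ : EqSet → Class → Eqn → Set₁
D ⊨[ K ] e = ∀ (A : ROL) → K A → ∀ (ρ : ℕ → ROL.Carrier A) →
             (∀ d → D d → SatBy A ρ d) → SatBy A ρ e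

ROLᵛ : Class
ROLᵛ A = ⊤

_+ᵉ_ : Class → EqSet → Class
(K +ᵉ E) A = K A × (∀ e → E e → Models A e)

-- OML: ROLs whose lattice reduct with ¬ is an orthomodular lattice and
-- whose \ is the Sasaki-type operation x \ y = ¬x ∨ (x ∧ y)
record IsOML (A : ROL) : Set where
  open ROL A
  field
    ∧-compl : ∀ x → (x ∧ ¬ x) ≈ 𝟘
    ∨-compl : ∀ x → (x ∨ ¬ x) ≈ 𝟙
    orthomodular : ∀ {x y} → x ≤ y → y ≈ (x ∨ (¬ x ∧ y))
    ⇛-def : ∀ x y → (x ⇛ y) ≈ (¬ x ∨ (x ∧ y))

OMLᵛ : Class
OMLᵛ A = IsOML A

∼ₜ_ : Term → Term
∼ₜ s = s ⇒ₜ 0ₜ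

T : Term → Term
T (var n)  = ∼ₜ (∼ₜ (var n))
T 0ₜ       = 0ₜ
T 1ₜ       = 1ₜ
T (¬ₜ s)   = ∼ₜ (T s)
T (s ∧ₜ t) = T s ∧ₜ T t
T (s ∨ₜ t) = T s ∨ₜ T t
T (s ⇒ₜ t) = T s ⇒ₜ T t

Tᵉ : Eqn → Eqn
Tᵉ (s , t) = (T s , T t)

T[_] : EqSet → EqSet
T[ E ] e = Σ[ d ∈ Eqn ] (E d × e ≡ Tᵉ d)

Translatable : Class → Class → Set₁
Translatable V W =
  ∀ (D : EqSet) (s t : Term) →
    (D ⊨[ V ] (s , t)) ⇔ (T[ D ] ⊨[ W ] (T s , T t))

-- In a residuated ortholattice the residual complement ∼x = x ⇛ 𝟘 is antitone with
-- x ≤ ∼∼x, and it satisfies both De Morgan laws; the ∧-law ∼(x ∧ y) ≈ ∼x ∨ ∼y is the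
-- crux, obtained from u · p ≤ p for regular p ≤ u. Consequently the regular elements
-- (∼∼x ≈ x) are closed under ∧, ∨, ⇛, 𝟘, 𝟙 and, with ∼ as orthocomplement, form an
-- orthomodular lattice whose residual is the Sasaki implication. Since T evaluates in A
-- as terms evaluate in this regular OML at ∼∼ρ, and T is the identity up to ≈ in an OML
-- (where ∼ = ¬), consequences transfer in both directions. OML itself is the case E = ∅.
module Submission where

open import Defs
open import Data.Nat using (ℕ)
open import Data.Product using (Σ; _×_; _,_; proj₁; proj₂)
open import Data.Unit.Polymorphic using (tt)
open import Function.Base using (_∘_)
open import Relation.Unary using (∅; _⊆_; _≐_)
open import Relation.Binary.PropositionalEquality as PE using ()
open import Function.Bundles using (_⇔_; mk⇔; Equivalence)
open import Algebra.Lattice.Bundles as Alg using ()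
open import Algebra.Lattice.Properties.Lattice using (∨-∧-isOrderTheoreticLattice)
open import Relation.Binary.Lattice as Ord using ()
import Relation.Binary.Lattice.Properties.JoinSemilattice as JoinProperties
import Relation.Binary.Lattice.Properties.MeetSemilattice as MeetProperties
import Relation.Binary.Reasoning.PartialOrder as ≤-Reasoning

module ROLProperties (A : ROL) where
  open ROL A

  private
    algebraicLattice : Alg.Lattice _ _
    algebraicLattice = record { isLattice = isLattice }

    module Natural = Ord.IsLattice (∨-∧-isOrderTheoreticLattice algebraicLattice)

  -- The library orders a lattice by x ≈ x ∧ y; ROL uses the symmetric x ∧ y ≈ x.
  orderLattice : Ord.Lattice _ _ _
  orderLattice = record
    { _≈_ = _≈_ ; _≤_ = _≤_ ; _∨_ = _∨_ ; _∧_ = _∧_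
    ; isLattice = record
      { isPartialOrder = record
        { isPreorder = record
          { isEquivalence = isEquivalence
          ; reflexive = λ x≈y → sym (Natural.reflexive x≈y)
          ; trans = λ x≤y y≤z → sym (Natural.trans (sym x≤y) (sym y≤z))
          }
        ; antisym = λ x≤y y≤x → Natural.antisym (sym x≤y) (sym y≤x)
        }
      ; supremum = λ x y → sym (Natural.x≤x∨y x y) , sym (Natural.y≤x∨y x y)
                         , λ z x≤z y≤z → sym (Natural.∨-least (sym x≤z) (sym y≤z))
      ; infimum = λ x y → sym (Natural.x∧y≤x x y) , sym (Natural.x∧y≤y x y)
                        , λ z z≤x z≤y → sym (Natural.∧-greatest (sym z≤x) (sym z≤y))
      }
    }

  open Ord.Lattice orderLattice public
    using (poset; x∧y≤x; x∧y≤y; ∧-greatest; x≤x∨y; y≤x∨y; ∨-least; ≤-respˡ-≈)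
    renaming (refl to ≤-refl; reflexive to ≤-reflexive; trans to ≤-trans; antisym to ≤-antisym)
  open JoinProperties (Ord.Lattice.joinSemilattice orderLattice) public
    using (∨-monotonic; x≤y⇒x∨y≈y)
  open MeetProperties (Ord.Lattice.meetSemilattice orderLattice) public
    using (∧-monotonic)
  open ≤-Reasoning poset

  x≤𝟘⇒x≈𝟘 : ∀ {x} → x ≤ 𝟘 → x ≈ 𝟘
  x≤𝟘⇒x≈𝟘 x≤𝟘 = ≤-antisym x≤𝟘 (𝟘-least _)

  𝟙≤x⇒x≈𝟙 : ∀ {x} → 𝟙 ≤ x → x ≈ 𝟙
  𝟙≤x⇒x≈𝟙 𝟙≤x = ≤-antisym (𝟙-greatest _) 𝟙≤x

  ∨-identityʳ : ∀ x → (x ∨ 𝟘) ≈ x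
  ∨-identityʳ x = trans (∨-comm x 𝟘) (x≤y⇒x∨y≈y (𝟘-least x))

  ¬-reflects-≤ : ∀ {x y} → ¬ x ≤ ¬ y → y ≤ x
  ¬-reflects-≤ ¬x≤¬y = begin
    _       ≈⟨ ¬-involutive _ ⟨
    ¬ ¬ _   ≤⟨ ¬-antitone ¬x≤¬y ⟩
    ¬ ¬ _   ≈⟨ ¬-involutive _ ⟩
    _       ∎

  x≤¬y⇒y≤¬x : ∀ {x y} → x ≤ ¬ y → y ≤ ¬ x
  x≤¬y⇒y≤¬x x≤¬y = ¬-reflects-≤ (≤-trans (≤-reflexive (¬-involutive _)) x≤¬y)

  ¬-deMorgan-∨ : ∀ x y → (¬ (x ∨ y)) ≈ (¬ x ∧ ¬ y)
  ¬-deMorgan-∨ x y = ≤-antisym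
    (∧-greatest (¬-antitone (x≤x∨y x y)) (¬-antitone (y≤x∨y x y)))
    (x≤¬y⇒y≤¬x (∨-least (x≤¬y⇒y≤¬x (x∧y≤x _ _)) (x≤¬y⇒y≤¬x (x∧y≤y _ _))))

  ¬-deMorgan-∧ : ∀ x y → (¬ (x ∧ y)) ≈ (¬ x ∨ ¬ y)
  ¬-deMorgan-∧ x y = begin-equality
    ¬ (x ∧ y)          ≈⟨ ¬-cong (∧-cong (¬-involutive x) (¬-involutive y)) ⟨
    ¬ (¬ ¬ x ∧ ¬ ¬ y)  ≈⟨ ¬-cong (¬-deMorgan-∨ (¬ x) (¬ y)) ⟨
    ¬ ¬ (¬ x ∨ ¬ y)    ≈⟨ ¬-involutive _ ⟩
    ¬ x ∨ ¬ y          ∎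

  ¬𝟘≈𝟙 : (¬ 𝟘) ≈ 𝟙
  ¬𝟘≈𝟙 = 𝟙≤x⇒x≈𝟙 (x≤¬y⇒y≤¬x (𝟘-least _))

  ¬x≤𝟘⇒x≈𝟙 : ∀ {x} → ¬ x ≤ 𝟘 → x ≈ 𝟙
  ¬x≤𝟘⇒x≈𝟙 ¬x≤𝟘 = 𝟙≤x⇒x≈𝟙 (¬-reflects-≤ (≤-trans ¬x≤𝟘 (𝟘-least _)))

  ·≤⇒≤⇛ : ∀ {x y z} → x · y ≤ z → y ≤ x ⇛ z
  ·≤⇒≤⇛ = Equivalence.to (residuated _ _ _)

  ≤⇛⇒·≤ : ∀ {x y z} → y ≤ x ⇛ z → x · y ≤ z
  ≤⇛⇒·≤ = Equivalence.from (residuated _ _ _)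

  -- x · _ is a left adjoint, so it preserves joins.
  ·-distribˡ-∨ : ∀ x y z → x · (y ∨ z) ≤ (x · y) ∨ (x · z)
  ·-distribˡ-∨ x y z = ≤⇛⇒·≤ (∨-least (·≤⇒≤⇛ (x≤x∨y _ _)) (·≤⇒≤⇛ (y≤x∨y _ _)))

  ·≈∧ : ∀ {x y} → ¬ x ≤ y → (x · y) ≈ (x ∧ y)
  ·≈∧ ¬x≤y = ∧-congˡ (x≤y⇒x∨y≈y ¬x≤y)

  ∧-distribˡ-∨-above-¬ : ∀ {x y z} → ¬ x ≤ y → ¬ x ≤ z → x ∧ (y ∨ z) ≤ (x ∧ y) ∨ (x ∧ z)
  ∧-distribˡ-∨-above-¬ {x} {y} {z} ¬x≤y ¬x≤z = begin
    x ∧ (y ∨ z)        ≈⟨ ·≈∧ (≤-trans ¬x≤y (x≤x∨y y z)) ⟨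
    x · (y ∨ z)        ≤⟨ ·-distribˡ-∨ x y z ⟩
    (x · y) ∨ (x · z)  ≈⟨ ∨-cong (·≈∧ ¬x≤y) (·≈∧ ¬x≤z) ⟩
    (x ∧ y) ∨ (x ∧ z)  ∎

  ∧-complementʳ : ∀ x → (x ∧ ¬ x) ≈ 𝟘
  ∧-complementʳ x = x≤𝟘⇒x≈𝟘 (begin
    x ∧ ¬ x          ≈⟨ ∧-congˡ (∨-identityʳ (¬ x)) ⟨
    x · 𝟘            ≤⟨ ≤⇛⇒·≤ (𝟘-least _) ⟩
    𝟘                ∎)

  ∼_ : Carrier → Carrier
  ∼ x = x ⇛ 𝟘

  ∼-cong : ∀ {x y} → x ≈ y → (∼ x) ≈ (∼ y)
  ∼-cong x≈y = ⇛-cong x≈y refl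

  x·∼x≤𝟘 : ∀ x → x · ∼ x ≤ 𝟘
  x·∼x≤𝟘 x = ≤⇛⇒·≤ ≤-refl

  ≤∼-intro : ∀ {x y} → ¬ x ≤ y → x ∧ y ≤ 𝟘 → y ≤ ∼ x
  ≤∼-intro ¬x≤y x∧y≤𝟘 = ·≤⇒≤⇛ (≤-trans (≤-reflexive (·≈∧ ¬x≤y)) x∧y≤𝟘)

  ¬x≤∼x : ∀ x → ¬ x ≤ ∼ x
  ¬x≤∼x x = ≤∼-intro ≤-refl (≤-reflexive (∧-complementʳ x))

  ∧-∼-complementʳ : ∀ x → (x ∧ ∼ x) ≈ 𝟘
  ∧-∼-complementʳ x = x≤𝟘⇒x≈𝟘 (≤-trans (≤-reflexive (sym (·≈∧ (¬x≤∼x x)))) (x·∼x≤𝟘 x))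

  ∧-∼-complementˡ : ∀ x → (∼ x ∧ x) ≈ 𝟘
  ∧-∼-complementˡ x = trans (∧-comm (∼ x) x) (∧-∼-complementʳ x)

  ¬∼x≤x : ∀ x → ¬ ∼ x ≤ x
  ¬∼x≤x x = ≤-trans (¬-antitone (¬x≤∼x x)) (≤-reflexive (¬-involutive x))

  x≤∼∼x : ∀ x → x ≤ ∼ ∼ x
  x≤∼∼x x = ≤∼-intro (¬∼x≤x x) (≤-reflexive (∧-∼-complementˡ x))

  ·≈∧∼∨ : ∀ x y → (x · y) ≈ (x ∧ (∼ x ∨ y))
  ·≈∧∼∨ x y = ≤-antisym
    (∧-monotonic ≤-refl (∨-monotonic (¬x≤∼x x) ≤-refl))
    (begin
      x ∧ (∼ x ∨ y)        ≈⟨ ·≈∧ (≤-trans (¬x≤∼x x) (x≤x∨y _ _)) ⟨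
      x · (∼ x ∨ y)        ≤⟨ ·-distribˡ-∨ x (∼ x) y ⟩
      (x · ∼ x) ∨ (x · y)  ≤⟨ ∨-least (≤-trans (x·∼x≤𝟘 x) (𝟘-least _)) ≤-refl ⟩
      x · y                ∎)

  ∼-antitone : ∀ {x y} → x ≤ y → ∼ y ≤ ∼ x
  ∼-antitone {x} {y} x≤y = ·≤⇒≤⇛ (begin
    x ∧ (¬ x ∨ ∼ y)              ≤⟨ ∧-greatest (x∧y≤x _ _) (∧-monotonic x≤y ≤-refl) ⟩
    x ∧ (y ∧ (¬ x ∨ ∼ y))        ≈⟨ ∧-congˡ (·≈∧ (≤-trans (¬-antitone x≤y) (x≤x∨y _ _))) ⟨
    x ∧ (y · (¬ x ∨ ∼ y))        ≤⟨ ∧-monotonic ≤-refl (·-distribˡ-∨ y (¬ x) (∼ y)) ⟩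
    x ∧ ((y · ¬ x) ∨ (y · ∼ y))  ≤⟨ ∧-monotonic ≤-refl (∨-least (≤-reflexive (·≈∧ (¬-antitone x≤y)))
                                                                (≤-trans (x·∼x≤𝟘 y) (𝟘-least _))) ⟩
    x ∧ (y ∧ ¬ x)                ≤⟨ ∧-monotonic ≤-refl (x∧y≤y _ _) ⟩
    x ∧ ¬ x                      ≈⟨ ∧-complementʳ x ⟩
    𝟘                            ∎)

  ≤∼-swap : ∀ {x y} → y ≤ ∼ x → x ≤ ∼ y
  ≤∼-swap y≤∼x = ≤-trans (x≤∼∼x _) (∼-antitone y≤∼x)

  Regular : Carrier → Set
  Regular x = (∼ ∼ x) ≈ x

  ∼-regular : ∀ x → Regular (∼ x)
  ∼-regular x = ≤-antisym (∼-antitone (x≤∼∼x x)) (x≤∼∼x (∼ x))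

  ∼-deMorgan-∨ : ∀ x y → (∼ (x ∨ y)) ≈ (∼ x ∧ ∼ y)
  ∼-deMorgan-∨ x y = ≤-antisym
    (∧-greatest (∼-antitone (x≤x∨y x y)) (∼-antitone (y≤x∨y x y)))
    (≤∼-swap (∨-least (≤∼-swap (x∧y≤x _ _)) (≤∼-swap (x∧y≤y _ _))))

  ∼𝟘≈𝟙 : (∼ 𝟘) ≈ 𝟙
  ∼𝟘≈𝟙 = 𝟙≤x⇒x≈𝟙 (·≤⇒≤⇛ (x∧y≤x _ _))

  ∼𝟙≈𝟘 : (∼ 𝟙) ≈ 𝟘
  ∼𝟙≈𝟘 = trans (sym (𝟙-greatest (∼ 𝟙))) (∧-∼-complementˡ 𝟙)

  ∨-∼-complementʳ : ∀ x → (x ∨ ∼ x) ≈ 𝟙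
  ∨-∼-complementʳ x = ¬x≤𝟘⇒x≈𝟙 (begin
    ¬ (x ∨ ∼ x)  ≤⟨ ∧-greatest (¬-antitone (x≤x∨y _ _)) (≤-trans (¬-antitone (y≤x∨y _ _)) (¬∼x≤x x)) ⟩
    ¬ x ∧ x      ≈⟨ ∧-comm (¬ x) x ⟩
    x ∧ ¬ x      ≈⟨ ∧-complementʳ x ⟩
    𝟘            ∎)

  ∼x≤x⇛y : ∀ x y → ∼ x ≤ x ⇛ y
  ∼x≤x⇛y x y = ·≤⇒≤⇛ (≤-trans (x·∼x≤𝟘 x) (𝟘-least y))

  x∧x⇛y≤y : ∀ x y → x ∧ (x ⇛ y) ≤ y
  x∧x⇛y≤y x y = ≤-trans (∧-monotonic ≤-refl (y≤x∨y _ _)) (≤⇛⇒·≤ ≤-refl)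

  ∼-monotone-of-null-difference : ∀ {p q} → p ≤ q → q ∧ ¬ p ≤ 𝟘 → ∼ p ≤ ∼ q
  ∼-monotone-of-null-difference {p} {q} p≤q q∧¬p≤𝟘 =
    ≤∼-intro (≤-trans (¬-antitone p≤q) (¬x≤∼x p)) t≤𝟘
    where
    t = q ∧ ∼ p
    ¬p∨¬t≈𝟙 : (¬ p ∨ ¬ t) ≈ 𝟙
    ¬p∨¬t≈𝟙 = begin-equality
      ¬ p ∨ ¬ t      ≈⟨ ¬-deMorgan-∧ p t ⟨
      ¬ (p ∧ t)      ≈⟨ ¬-cong (x≤𝟘⇒x≈𝟘 (≤-trans (∧-monotonic ≤-refl (x∧y≤y _ _))
                                                  (≤-reflexive (∧-∼-complementʳ p)))) ⟩
      ¬ 𝟘            ≈⟨ ¬𝟘≈𝟙 ⟩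
      𝟙              ∎
    q≤¬t : q ≤ ¬ t
    q≤¬t = begin
      q                      ≈⟨ 𝟙-greatest q ⟨
      q ∧ 𝟙                  ≈⟨ ∧-congˡ ¬p∨¬t≈𝟙 ⟨
      q ∧ (¬ p ∨ ¬ t)        ≤⟨ ∧-distribˡ-∨-above-¬ (¬-antitone p≤q) (¬-antitone (x∧y≤x _ _)) ⟩
      (q ∧ ¬ p) ∨ (q ∧ ¬ t)  ≤⟨ ∨-least (≤-trans q∧¬p≤𝟘 (𝟘-least _)) (x∧y≤y _ _) ⟩
      ¬ t                    ∎
    t≤𝟘 : t ≤ 𝟘
    t≤𝟘 = begin
      t          ≤⟨ ∧-greatest ≤-refl (≤-trans (x∧y≤x _ _) q≤¬t) ⟩
      t ∧ ¬ t    ≈⟨ ∧-complementʳ t ⟩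
      𝟘          ∎

  u·p≤p-if-regular : ∀ {p u} → Regular p → p ≤ u → u · p ≤ p
  u·p≤p-if-regular {p} {u} p-regular p≤u = begin
    u · p        ≤⟨ x≤∼∼x (u · p) ⟩
    ∼ ∼ (u · p)  ≤⟨ ∼-antitone (∼-monotone-of-null-difference p≤u·p u·p∧¬p≤𝟘) ⟩
    ∼ ∼ p        ≈⟨ p-regular ⟩
    p            ∎
    where
    e = u ∧ ¬ p
    p≤u·p : p ≤ u · p
    p≤u·p = ∧-greatest p≤u (y≤x∨y _ _)
    u·p∧¬p≤𝟘 : (u · p) ∧ ¬ p ≤ 𝟘
    u·p∧¬p≤𝟘 = begin
      (u · p) ∧ ¬ p    ≤⟨ ∧-greatest (∧-greatest (≤-trans (x∧y≤x _ _) (x∧y≤x _ _)) (x∧y≤y _ _))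
                                     (≤-trans (x∧y≤x _ _) (x∧y≤y _ _)) ⟩
      e ∧ (¬ u ∨ p)    ≈⟨ ∧-congˡ (trans (¬-deMorgan-∧ u (¬ p)) (∨-congˡ (¬-involutive p))) ⟨
      e ∧ ¬ e          ≈⟨ ∧-complementʳ e ⟩
      𝟘                ∎

  ¬[¬x∨∼y]≤x∧y : ∀ x y → ¬ (¬ x ∨ ∼ y) ≤ x ∧ y
  ¬[¬x∨∼y]≤x∧y x y = begin
    ¬ (¬ x ∨ ∼ y)    ≈⟨ ¬-deMorgan-∨ (¬ x) (∼ y) ⟩
    ¬ ¬ x ∧ ¬ ∼ y    ≤⟨ ∧-monotonic (≤-reflexive (¬-involutive x)) (¬∼x≤x y) ⟩
    x ∧ y            ∎

  ∼-deMorgan-∧ : ∀ x y → (∼ (x ∧ y)) ≈ (∼ x ∨ ∼ y)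
  ∼-deMorgan-∧ x y = ≤-antisym ∼[x∧y]≤∼x∨∼y (∨-least (∼-antitone (x∧y≤x x y)) (∼-antitone (x∧y≤y x y)))
    where
    u = ∼ (x ∧ y)
    s = ¬ u ∨ ∼ x
    s′ = ¬ u ∨ ∼ y
    s∨s′≈𝟙 : (s ∨ s′) ≈ 𝟙
    s∨s′≈𝟙 = ¬x≤𝟘⇒x≈𝟙 (begin
      ¬ (s ∨ s′)               ≈⟨ ¬-deMorgan-∨ s s′ ⟩
      ¬ s ∧ ¬ s′               ≤⟨ ∧-monotonic (¬[¬x∨∼y]≤x∧y u x) (¬[¬x∨∼y]≤x∧y u y) ⟩
      (u ∧ x) ∧ (u ∧ y)        ≤⟨ ∧-greatest (≤-trans (x∧y≤x _ _) (x∧y≤x _ _))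
                                             (∧-monotonic (x∧y≤y _ _) (x∧y≤y _ _)) ⟩
      u ∧ (x ∧ y)              ≈⟨ ∧-∼-complementˡ (x ∧ y) ⟩
      𝟘                        ∎)
    ∼[x∧y]≤∼x∨∼y : u ≤ ∼ x ∨ ∼ y
    ∼[x∧y]≤∼x∨∼y = begin
      u                    ≤⟨ ∧-greatest ≤-refl (≤-trans (𝟙-greatest u) (≤-reflexive (sym s∨s′≈𝟙))) ⟩
      u ∧ (s ∨ s′)         ≤⟨ ∧-distribˡ-∨-above-¬ (x≤x∨y _ _) (x≤x∨y _ _) ⟩
      (u ∧ s) ∨ (u ∧ s′)   ≤⟨ ∨-monotonic (u·p≤p-if-regular (∼-regular x) (∼-antitone (x∧y≤x x y)))
                                          (u·p≤p-if-regular (∼-regular y) (∼-antitone (x∧y≤y x y))) ⟩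
      ∼ x ∨ ∼ y            ∎

  ∼∼-distrib-∧ : ∀ x y → (∼ ∼ (x ∧ y)) ≈ (∼ ∼ x ∧ ∼ ∼ y)
  ∼∼-distrib-∧ x y = trans (∼-cong (∼-deMorgan-∧ x y)) (∼-deMorgan-∨ (∼ x) (∼ y))

  𝟘-regular : Regular 𝟘
  𝟘-regular = trans (∼-cong ∼𝟘≈𝟙) ∼𝟙≈𝟘

  𝟙-regular : Regular 𝟙
  𝟙-regular = trans (∼-cong ∼𝟙≈𝟘) ∼𝟘≈𝟙

  ∧-regular : ∀ {x y} → Regular x → Regular y → Regular (x ∧ y)
  ∧-regular x-regular y-regular = trans (∼∼-distrib-∧ _ _) (∧-cong x-regular y-regular)

  ∨-regular : ∀ {x y} → Regular x → Regular y → Regular (x ∨ y)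
  ∨-regular {x} {y} x-regular y-regular = begin-equality
    ∼ ∼ (x ∨ y)      ≈⟨ ∼-cong (∼-deMorgan-∨ x y) ⟩
    ∼ (∼ x ∧ ∼ y)    ≈⟨ ∼-deMorgan-∧ (∼ x) (∼ y) ⟩
    ∼ ∼ x ∨ ∼ ∼ y    ≈⟨ ∨-cong x-regular y-regular ⟩
    x ∨ y            ∎

  ⇛-regular : ∀ {x y} → Regular x → Regular y → Regular (x ⇛ y)
  ⇛-regular {x} {y} x-regular y-regular = ≤-antisym (·≤⇒≤⇛ (begin
      x · ∼ ∼ z             ≈⟨ ·≈∧∼∨ x (∼ ∼ z) ⟩
      x ∧ (∼ x ∨ ∼ ∼ z)     ≈⟨ ∧-congˡ (x≤y⇒x∨y≈y (≤-trans (∼x≤x⇛y x y) (x≤∼∼x z))) ⟩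
      x ∧ ∼ ∼ z             ≈⟨ ∧-congʳ x-regular ⟨
      ∼ ∼ x ∧ ∼ ∼ z         ≈⟨ ∼∼-distrib-∧ x z ⟨
      ∼ ∼ (x ∧ z)           ≤⟨ ∼-antitone (∼-antitone (x∧x⇛y≤y x y)) ⟩
      ∼ ∼ y                 ≈⟨ y-regular ⟩
      y                     ∎)) (x≤∼∼x _)
    where
    z = x ⇛ y

  regular-orthomodular : ∀ {p q} → Regular p → Regular q → p ≤ q → q ≤ p ∨ (∼ p ∧ q)
  regular-orthomodular {p} {q} p-regular q-regular p≤q = begin
    q       ≈⟨ q-regular ⟨
    ∼ ∼ q   ≤⟨ ∼-antitone ∼t≤∼q ⟩
    ∼ ∼ t   ≈⟨ ∨-regular p-regular (∧-regular (∼-regular p) q-regular) ⟩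
    t       ∎
    where
    e = ∼ p ∧ q
    t = p ∨ e
    ∼e≈p∨∼q : (∼ e) ≈ (p ∨ ∼ q)
    ∼e≈p∨∼q = trans (∼-deMorgan-∧ (∼ p) q) (∨-congʳ p-regular)
    e≈∼[p∨∼q] : e ≈ (∼ (p ∨ ∼ q))
    e≈∼[p∨∼q] = sym (trans (∼-deMorgan-∨ p (∼ q)) (∧-congˡ q-regular))
    q∧∼t≤𝟘 : q ∧ ∼ t ≤ 𝟘
    q∧∼t≤𝟘 = begin
      q ∧ ∼ t                  ≈⟨ ∧-congˡ (∼-deMorgan-∨ p e) ⟩
      q ∧ (∼ p ∧ ∼ e)          ≤⟨ ∧-greatest (∧-greatest (≤-trans (x∧y≤y _ _) (x∧y≤x _ _)) (x∧y≤x _ _))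
                                             (≤-trans (x∧y≤y _ _) (x∧y≤y _ _)) ⟩
      e ∧ ∼ e                  ≈⟨ ∧-cong e≈∼[p∨∼q] ∼e≈p∨∼q ⟩
      ∼ (p ∨ ∼ q) ∧ (p ∨ ∼ q)  ≈⟨ ∧-∼-complementˡ (p ∨ ∼ q) ⟩
      𝟘                        ∎
    ∼t≤∼q : ∼ t ≤ ∼ q
    ∼t≤∼q = ≤∼-intro (≤-trans (¬x≤∼x q) (∼-antitone (∨-least p≤q (x∧y≤y _ _)))) q∧∼t≤𝟘

  regular-⇛-sasaki : ∀ {x y} → Regular x → Regular y → (x ⇛ y) ≈ (∼ x ∨ (x ∧ y))
  regular-⇛-sasaki {x} {y} x-regular y-regular = ≤-antisym
    (begin
      z                     ≤⟨ regular-orthomodular (∼-regular x) (⇛-regular x-regular y-regular) (∼x≤x⇛y x y) ⟩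
      ∼ x ∨ (∼ ∼ x ∧ z)     ≈⟨ ∨-congˡ (∧-congʳ x-regular) ⟩
      ∼ x ∨ (x ∧ z)         ≤⟨ ∨-monotonic ≤-refl (∧-greatest (x∧y≤x _ _) (x∧x⇛y≤y x y)) ⟩
      ∼ x ∨ (x ∧ y)         ∎)
    (·≤⇒≤⇛ (begin
      x · w                 ≈⟨ ·≈∧∼∨ x w ⟩
      x ∧ (∼ x ∨ w)         ≈⟨ ∧-congˡ (x≤y⇒x∨y≈y (x≤x∨y _ _)) ⟩
      x ∧ w                 ≈⟨ ·≈∧∼∨ x (x ∧ y) ⟨
      x · (x ∧ y)           ≤⟨ u·p≤p-if-regular (∧-regular x-regular y-regular) (x∧y≤x x y) ⟩
      x ∧ y                 ≤⟨ x∧y≤y x y ⟩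
      y                     ∎))
    where
    z = x ⇛ y
    w = ∼ x ∨ (x ∧ y)

record T-Agree (B : ROL) (σ : ℕ → ROL.Carrier B) (A : ROL) (ρ : ℕ → ROL.Carrier A) : Set where
  field
    satBy⇔satBy-T : ∀ e → SatBy B σ e ⇔ SatBy A ρ (Tᵉ e)

  satBy-T[]⇔satBy : ∀ D → (∀ d → D d → SatBy B σ d) ⇔ (∀ d → T[ D ] d → SatBy A ρ d)
  satBy-T[]⇔satBy D = mk⇔
    (λ σ⊨D → λ { ._ (d , d∈D , PE.refl) → Equivalence.to (satBy⇔satBy-T d) (σ⊨D d d∈D) })
    (λ ρ⊨T[D] d d∈D → Equivalence.from (satBy⇔satBy-T d) (ρ⊨T[D] (Tᵉ d) (d , d∈D , PE.refl)))

module RegularAlgebra (A : ROL) where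
  open ROL A
  open ROLProperties A

  RegularElement : Set
  RegularElement = Σ Carrier Regular

  regularAlgebra : ROL
  regularAlgebra = record
    { Carrier = RegularElement
    ; _≈_ = λ x y → proj₁ x ≈ proj₁ y
    ; _∧_ = λ (x , x-reg) (y , y-reg) → (x ∧ y , ∧-regular x-reg y-reg)
    ; _∨_ = λ (x , x-reg) (y , y-reg) → (x ∨ y , ∨-regular x-reg y-reg)
    ; _⇛_ = λ (x , x-reg) (y , y-reg) → (x ⇛ y , ⇛-regular x-reg y-reg)
    ; ¬_ = λ (x , _) → (∼ x , ∼-regular x)
    ; 𝟘 = (𝟘 , 𝟘-regular)
    ; 𝟙 = (𝟙 , 𝟙-regular)
    ; isLattice = record
      { isEquivalence = record { refl = refl ; sym = sym ; trans = trans }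
      ; ∨-comm = λ x y → ∨-comm (proj₁ x) (proj₁ y)
      ; ∨-assoc = λ x y z → ∨-assoc (proj₁ x) (proj₁ y) (proj₁ z)
      ; ∨-cong = ∨-cong
      ; ∧-comm = λ x y → ∧-comm (proj₁ x) (proj₁ y)
      ; ∧-assoc = λ x y z → ∧-assoc (proj₁ x) (proj₁ y) (proj₁ z)
      ; ∧-cong = ∧-cong
      ; absorptive = (λ x y → ∨-absorbs-∧ (proj₁ x) (proj₁ y))
                   , (λ x y → ∧-absorbs-∨ (proj₁ x) (proj₁ y))
      }
    ; 𝟘-least = λ x → 𝟘-least (proj₁ x)
    ; 𝟙-greatest = λ x → 𝟙-greatest (proj₁ x)
    ; ¬-cong = ∼-cong
    ; ¬-involutive = proj₂
    ; ¬-antitone = ∼-antitone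
    ; ⇛-cong = ⇛-cong
    ; residuated = λ (x , _) (y , _) (z , _) → mk⇔
        (λ x∧[∼x∨y]≤z → ·≤⇒≤⇛ (≤-respˡ-≈ (sym (·≈∧∼∨ x y)) x∧[∼x∨y]≤z))
        (λ y≤x⇛z → ≤-respˡ-≈ (·≈∧∼∨ x y) (≤⇛⇒·≤ y≤x⇛z))
    }

  regularAlgebra-isOML : IsOML regularAlgebra
  regularAlgebra-isOML = record
    { ∧-compl = λ (x , _) → ∧-∼-complementʳ x
    ; ∨-compl = λ (x , _) → ∨-∼-complementʳ x
    ; orthomodular = λ {(x , x-reg)} {(y , y-reg)} x≤y →
        ≤-antisym (regular-orthomodular x-reg y-reg x≤y) (∨-least x≤y (x∧y≤y _ _))
    ; ⇛-def = λ (x , x-reg) (y , y-reg) → regular-⇛-sasaki x-reg y-reg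
    }

  ⟦T⟧-regularAlgebra : (σ : ℕ → RegularElement) (ρ : ℕ → Carrier) →
                       (∀ n → proj₁ (σ n) ≈ (∼ ∼ ρ n)) →
                       ∀ s → proj₁ (⟦_⟧ regularAlgebra s σ) ≈ ⟦_⟧ A (T s) ρ
  ⟦T⟧-regularAlgebra σ ρ σ≈∼∼ρ (var n)  = σ≈∼∼ρ n
  ⟦T⟧-regularAlgebra σ ρ σ≈∼∼ρ 0ₜ       = refl
  ⟦T⟧-regularAlgebra σ ρ σ≈∼∼ρ 1ₜ       = refl
  ⟦T⟧-regularAlgebra σ ρ σ≈∼∼ρ (¬ₜ s)   = ∼-cong (⟦T⟧-regularAlgebra σ ρ σ≈∼∼ρ s)
  ⟦T⟧-regularAlgebra σ ρ σ≈∼∼ρ (s ∧ₜ t) =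
    ∧-cong (⟦T⟧-regularAlgebra σ ρ σ≈∼∼ρ s) (⟦T⟧-regularAlgebra σ ρ σ≈∼∼ρ t)
  ⟦T⟧-regularAlgebra σ ρ σ≈∼∼ρ (s ∨ₜ t) =
    ∨-cong (⟦T⟧-regularAlgebra σ ρ σ≈∼∼ρ s) (⟦T⟧-regularAlgebra σ ρ σ≈∼∼ρ t)
  ⟦T⟧-regularAlgebra σ ρ σ≈∼∼ρ (s ⇒ₜ t) =
    ⇛-cong (⟦T⟧-regularAlgebra σ ρ σ≈∼∼ρ s) (⟦T⟧-regularAlgebra σ ρ σ≈∼∼ρ t)

  regularAlgebra-T-Agree : (σ : ℕ → RegularElement) (ρ : ℕ → Carrier) →
                           (∀ n → proj₁ (σ n) ≈ (∼ ∼ ρ n)) → T-Agree regularAlgebra σ A ρ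
  regularAlgebra-T-Agree σ ρ σ≈∼∼ρ .T-Agree.satBy⇔satBy-T (u , v) = mk⇔
    (λ u≈v → trans (sym (⟦T⟧ u)) (trans u≈v (⟦T⟧ v)))
    (λ Tu≈Tv → trans (⟦T⟧ u) (trans Tu≈Tv (sym (⟦T⟧ v))))
    where
    ⟦T⟧ : ∀ s → proj₁ (⟦_⟧ regularAlgebra s σ) ≈ ⟦_⟧ A (T s) ρ
    ⟦T⟧ = ⟦T⟧-regularAlgebra σ ρ σ≈∼∼ρ

module OMLTranslation (A : ROL) (A-isOML : IsOML A) where
  open ROL A
  open ROLProperties A
  open IsOML A-isOML

  ∼≈¬ : ∀ x → (∼ x) ≈ (¬ x)
  ∼≈¬ x = begin-equality
    x ⇛ 𝟘              ≈⟨ ⇛-def x 𝟘 ⟩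
    ¬ x ∨ (x ∧ 𝟘)      ≈⟨ ∨-congˡ (trans (∧-comm x 𝟘) (𝟘-least x)) ⟩
    ¬ x ∨ 𝟘            ≈⟨ ∨-identityʳ (¬ x) ⟩
    ¬ x                ∎
    where open ≤-Reasoning poset

  ⟦T⟧-OML : ∀ s ρ → ⟦_⟧ A (T s) ρ ≈ ⟦_⟧ A s ρ
  ⟦T⟧-OML (var n)  ρ = trans (∼≈¬ _) (trans (¬-cong (∼≈¬ (ρ n))) (¬-involutive (ρ n)))
  ⟦T⟧-OML 0ₜ       ρ = refl
  ⟦T⟧-OML 1ₜ       ρ = refl
  ⟦T⟧-OML (¬ₜ s)   ρ = trans (∼≈¬ _) (¬-cong (⟦T⟧-OML s ρ))
  ⟦T⟧-OML (s ∧ₜ t) ρ = ∧-cong (⟦T⟧-OML s ρ) (⟦T⟧-OML t ρ)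
  ⟦T⟧-OML (s ∨ₜ t) ρ = ∨-cong (⟦T⟧-OML s ρ) (⟦T⟧-OML t ρ)
  ⟦T⟧-OML (s ⇒ₜ t) ρ = ⇛-cong (⟦T⟧-OML s ρ) (⟦T⟧-OML t ρ)

  OML-T-Agree : ∀ ρ → T-Agree A ρ A ρ
  OML-T-Agree ρ .T-Agree.satBy⇔satBy-T (u , v) = mk⇔
    (λ u≈v → trans (⟦T⟧-OML u ρ) (trans u≈v (sym (⟦T⟧-OML v ρ))))
    (λ Tu≈Tv → trans (sym (⟦T⟧-OML u ρ)) (trans Tu≈Tv (⟦T⟧-OML v ρ)))

OML+E-translatable : (E : EqSet) → Translatable (OMLᵛ +ᵉ E) (ROLᵛ +ᵉ T[ E ])
OML+E-translatable E D s t = mk⇔ to from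
  where
  open T-Agree
  to : D ⊨[ OMLᵛ +ᵉ E ] (s , t) → T[ D ] ⊨[ ROLᵛ +ᵉ T[ E ] ] (T s , T t)
  to D⊨s≈t A (_ , A⊨T[E]) ρ ρ⊨T[D] =
    Equivalence.to (satBy⇔satBy-T agree (s , t))
      (D⊨s≈t regularAlgebra (regularAlgebra-isOML , regularAlgebra⊨E) ∼∼ρ
             (Equivalence.from (satBy-T[]⇔satBy agree D) ρ⊨T[D]))
    where
    open RegularAlgebra A
    open ROL A using (refl; sym)
    open ROLProperties A using (∼_; ∼-regular)
    ∼∼ρ : ℕ → RegularElement
    ∼∼ρ n = (∼ ∼ ρ n , ∼-regular (∼ ρ n))
    agree : T-Agree regularAlgebra ∼∼ρ A ρ
    agree = regularAlgebra-T-Agree ∼∼ρ ρ (λ _ → refl)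
    regularAlgebra⊨E : ∀ e → E e → Models regularAlgebra e
    regularAlgebra⊨E e e∈E σ = Equivalence.from (satBy-T[]⇔satBy agreeσ E)
                                 (λ d d∈T[E] → A⊨T[E] d d∈T[E] (proj₁ ∘ σ)) e e∈E
      where
      agreeσ : T-Agree regularAlgebra σ A (proj₁ ∘ σ)
      agreeσ = regularAlgebra-T-Agree σ (proj₁ ∘ σ) (λ n → sym (proj₂ (σ n)))
  from : T[ D ] ⊨[ ROLᵛ +ᵉ T[ E ] ] (T s , T t) → D ⊨[ OMLᵛ +ᵉ E ] (s , t)
  from T[D]⊨Ts≈Tt A (A-isOML , A⊨E) ρ ρ⊨D =
    Equivalence.from (satBy⇔satBy-T (OML-T-Agree ρ) (s , t))
      (T[D]⊨Ts≈Tt A (_ , A⊨T[E]) ρ (Equivalence.to (satBy-T[]⇔satBy (OML-T-Agree ρ) D) ρ⊨D))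
    where
    open OMLTranslation A A-isOML
    A⊨T[E] : ∀ e → T[ E ] e → Models A e
    A⊨T[E] e e∈T[E] ρ′ =
      Equivalence.to (satBy-T[]⇔satBy (OML-T-Agree ρ′) E) (λ d d∈E → A⊨E d d∈E ρ′) e e∈T[E]

⊨-antitone : ∀ {K K′ D e} → K ⊆ K′ → D ⊨[ K′ ] e → D ⊨[ K ] e
⊨-antitone K⊆K′ D⊨e A A∈K = D⊨e A (K⊆K′ A∈K)

Translatable-resp-≐ : ∀ {V V′ W W′} → V ≐ V′ → W ≐ W′ → Translatable V W → Translatable V′ W′
Translatable-resp-≐ (V⊆V′ , V′⊆V) (W⊆W′ , W′⊆W) V↝W D s t = mk⇔
  (λ D⊨s≈t → ⊨-antitone {e = T s , T t} W′⊆W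
               (Equivalence.to (V↝W D s t) (⊨-antitone {e = s , t} V⊆V′ D⊨s≈t)))
  (λ T[D]⊨Ts≈Tt → ⊨-antitone {e = s , t} V′⊆V
                    (Equivalence.from (V↝W D s t) (⊨-antitone {e = T s , T t} W⊆W′ T[D]⊨Ts≈Tt)))

OML+∅≐OML : (OMLᵛ +ᵉ ∅) ≐ OMLᵛ
OML+∅≐OML = proj₁ , λ A-isOML → A-isOML , λ _ ()

ROL+T[∅]≐ROL : (ROLᵛ +ᵉ T[ ∅ ]) ≐ ROLᵛ
ROL+T[∅]≐ROL = proj₁ , λ _ → tt , λ { _ (_ , () , _) }

corollary4p12 : ((E : EqSet) → Translatable (OMLᵛ +ᵉ E) (ROLᵛ +ᵉ T[ E ]))
                × Translatable OMLᵛ ROLᵛ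
corollary4p12 =
  OML+E-translatable , Translatable-resp-≐ OML+∅≐OML ROL+T[∅]≐ROL (OML+E-translatable ∅)
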